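{- For every odd integer $t>1$ there exist integers $k_0,k_1,k_2,k_3$ with $\frac{t-1}{2}\ge k_0\ge k_1\ge k_2\ge k_3\ge 0$ such that $$\sum_{i=0}^3\frac{k_i(t-k_i)}{2}=\frac{t(t-1)}{2},$$ i.e. at least one distribution exists.
   Context: A distribution (for odd $t>1$) is an ordered tuple $\big(\frac{k_0(t-k_0)}{2},\frac{k_1(t-k_1)}{2},\frac{k_2(t-k_2)}{2},\frac{k_3(t-k_3)}{2}\big)$ of integers with $\frac{t-1}{2}\ge k_0\ge k_1\ge k_2\ge k_3\ge0$ satisfying $\sum_{i=0}^3\frac{k_i(t-k_i)}{2}=\frac{t(t-1)}{2}$. -}

module Defs where

open import Data.Nat using (ℕ; _+_; _*_; _∸_; _≤_; _/_)
open import Data.Product using (Σ; _×_)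
open import Relation.Binary.PropositionalEquality using (_≡_)

-- the entry k(t-k)/2 of a distribution (exact division: t odd, k ≤ t)
entry : ℕ → ℕ → ℕ
entry t k = (k * (t ∸ k)) / 2

IsDistribution : ℕ → ℕ → ℕ → ℕ → ℕ → Set
IsDistribution t k₀ k₁ k₂ k₃ =
  (k₀ ≤ (t ∸ 1) / 2) × (k₁ ≤ k₀) × (k₂ ≤ k₁) × (k₃ ≤ k₂) ×
  (entry t k₀ + entry t k₁ + entry t k₂ + entry t k₃ ≡ (t * (t ∸ 1)) / 2)

-- Write t = 2h + 1 and kᵢ = h - bᵢ. Then t - 2kᵢ = 2bᵢ + 1 and 8 · kᵢ(t - kᵢ)/2 = t² - (2bᵢ + 1)², so the entries
-- sum to t(t - 1)/2 exactly when (2b₁ + 1)² + (2b₂ + 1)² + (2b₃ + 1)² + (2b₄ + 1)² = 4t; sorting then orders the kᵢ.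
-- By Lagrange's four-square theorem t = x₁² + x₂² + x₃² + x₄², and as t is odd so is s = x₁ + x₂ + x₃ + x₄; the odd
-- numbers s, s - 2(x₃ + x₄), s - 2(x₂ + x₄), s - 2(x₂ + x₃) have squares summing to 4t.
-- Lagrange's theorem is proved classically: Euler's identity reduces it to primes; for an odd prime p = 2h + 1 the
-- pigeonhole principle gives p ∣ x² + y² + 1 with x, y ≤ h, and Lagrange's descent lowers the multiplier m in a
-- representation of m p until m = 1.

module Submission where

open import Defs
open import Data.Nat as ℕ using (ℕ; zero; suc; z≤n; s≤s; NonZero; _<_; _≤_; _∸_; _%_; _/_)
import Data.Nat.Properties as ℕ
open import Data.Nat.DivMod using (m≡m%n+[m/n]*n; m%n<n; m*n/n≡m)
open import Data.Nat.Divisibility as ℕ using (_∣_; divides; m%n≡0⇒n∣m; _∣?_)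
open import Data.Nat.Tactic.RingSolver as ℕ-Solver using ()
open import Data.Product using (Σ; ∃-syntax; _×_; _,_; proj₁; proj₂)
open import Data.Sum using (_⊎_; inj₁; inj₂; [_,_]′)
open import Data.Empty using (⊥-elim)
open import Relation.Nullary using (¬_; Dec; yes; no)
open import Relation.Binary.PropositionalEquality

module Lagrange where

  open import Data.Nat.ListAction using (product)
  open import Data.Nat.Induction using (<-wellFounded)
  open import Data.Nat.Primality using (Prime; prime⇒irreducible; euclidsLemma; ¬prime[1])
  open import Data.Nat.Primality.Factorisation using (factorise; PrimeFactorisation)
  open import Data.Integer as ℤ using (ℤ; +_; -[1+_]; ∣_∣; _+_; _*_; _-_; -_; 0ℤ; 1ℤ; -1ℤ; _%ℕ_; _/ℕ_)
  import Data.Integer.Properties as ℤ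
  import Data.Integer.DivMod as ℤ
  open import Data.Integer.Divisibility.Signed as ℤ using (divides; ∣⇒∣ᵤ; ∣m⇒∣-m)
  open import Data.Integer.Tactic.RingSolver using (solve-∀)
  open import Data.Fin as Fin using (Fin; toℕ; fromℕ<; splitAt; join)
  import Data.Fin.Properties as Fin
  open import Data.List.Relation.Unary.All using (All; []; _∷_)
  open import Induction.WellFounded using (Acc; acc)

  sumOfSquares : ℤ → ℤ → ℤ → ℤ → ℤ
  sumOfSquares a b c d = a * a + b * b + c * c + d * d

  record FourSquares (n : ℕ) : Set where
    constructor fourSquares
    field
      a b c d : ℤ
      sum≡n   : sumOfSquares a b c d ≡ + n

  euler-four-square : ∀ x₁ x₂ x₃ x₄ y₁ y₂ y₃ y₄ →
    (x₁ * x₁ + x₂ * x₂ + x₃ * x₃ + x₄ * x₄) * (y₁ * y₁ + y₂ * y₂ + y₃ * y₃ + y₄ * y₄) ≡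
      (x₁ * y₁ + x₂ * y₂ + x₃ * y₃ + x₄ * y₄) * (x₁ * y₁ + x₂ * y₂ + x₃ * y₃ + x₄ * y₄)
    + (x₁ * y₂ - x₂ * y₁ + x₃ * y₄ - x₄ * y₃) * (x₁ * y₂ - x₂ * y₁ + x₃ * y₄ - x₄ * y₃)
    + (x₁ * y₃ - x₃ * y₁ + x₄ * y₂ - x₂ * y₄) * (x₁ * y₃ - x₃ * y₁ + x₄ * y₂ - x₂ * y₄)
    + (x₁ * y₄ - x₄ * y₁ + x₂ * y₃ - x₃ * y₂) * (x₁ * y₄ - x₄ * y₁ + x₂ * y₃ - x₃ * y₂)
  euler-four-square = solve-∀

  fourSquares-* : ∀ {m n} → FourSquares m → FourSquares n → FourSquares (m ℕ.* n)
  fourSquares-* {m} {n} (fourSquares x₁ x₂ x₃ x₄ x≡m) (fourSquares y₁ y₂ y₃ y₄ y≡n) =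
    fourSquares (x₁ * y₁ + x₂ * y₂ + x₃ * y₃ + x₄ * y₄) (x₁ * y₂ - x₂ * y₁ + x₃ * y₄ - x₄ * y₃)
                (x₁ * y₃ - x₃ * y₁ + x₄ * y₂ - x₂ * y₄) (x₁ * y₄ - x₄ * y₁ + x₂ * y₃ - x₃ * y₂) (begin
      _                                                    ≡⟨ euler-four-square x₁ x₂ x₃ x₄ y₁ y₂ y₃ y₄ ⟨
      sumOfSquares x₁ x₂ x₃ x₄ * sumOfSquares y₁ y₂ y₃ y₄ ≡⟨ cong₂ _*_ x≡m y≡n ⟩
      + m * + n                                            ≡⟨ ℤ.pos-* m n ⟨
      + (m ℕ.* n)                                          ∎)
    where open ≡-Reasoning

  record SymmetricResidue (m : ℕ) (x : ℤ) : Set where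
    constructor symmetricResidue
    field
      residue quotient : ℤ
      decomposition    : x ≡ residue + + m * quotient
      2∣residue∣≤m     : 2 ℕ.* ∣ residue ∣ ≤ m

  reduceSymmetric : ∀ m .{{_ : NonZero m}} x → SymmetricResidue m x
  reduceSymmetric m x = choose (2 ℕ.* r ℕ.≤? m)
    where
    r = x %ℕ m
    q = x /ℕ m
    x≡r+qm : x ≡ + r + q * + m
    x≡r+qm = ℤ.a≡a%ℕn+[a/ℕn]*n x m
    r≤m : r ≤ m
    r≤m = ℕ.<⇒≤ (ℤ.n%ℕd<d x m)

    shift : ∀ r q m → r + q * m ≡ (r - m) + m * (q + 1ℤ)
    shift = solve-∀

    2∣r-m∣≤m : m < 2 ℕ.* r → 2 ℕ.* ∣ + r - + m ∣ ≤ m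
    2∣r-m∣≤m m<2r rewrite ℤ.[+m]-[+n]≡m⊖n r m | ℤ.∣⊖∣-≤ r≤m = ℕ.+-cancelʳ-≤ (2 ℕ.* r) _ _ (begin
      2 ℕ.* (m ℕ.∸ r) ℕ.+ 2 ℕ.* r  ≡⟨ ℕ.*-distribˡ-+ 2 (m ℕ.∸ r) r ⟨
      2 ℕ.* (m ℕ.∸ r ℕ.+ r)        ≡⟨ cong (2 ℕ.*_) (ℕ.m∸n+n≡m r≤m) ⟩
      2 ℕ.* m                      ≡⟨⟩
      m ℕ.+ 1 ℕ.* m                ≤⟨ ℕ.+-monoʳ-≤ m (ℕ.≤-trans (ℕ.≤-reflexive (ℕ.*-identityˡ m)) (ℕ.<⇒≤ m<2r)) ⟩
      m ℕ.+ 2 ℕ.* r                ∎)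
      where open ℕ.≤-Reasoning

    choose : Dec (2 ℕ.* r ≤ m) → SymmetricResidue m x
    choose (yes 2r≤m) = symmetricResidue (+ r) q (trans x≡r+qm (cong (_+_ (+ r)) (ℤ.*-comm q (+ m)))) 2r≤m
    choose (no 2r≰m)  = symmetricResidue (+ r - + m) (q + 1ℤ) (trans x≡r+qm (shift (+ r) q (+ m))) (2∣r-m∣≤m (ℕ.≰⇒> 2r≰m))

  sumOfSquares-cong : ∀ {a b c d a′ b′ c′ d′} → a ≡ a′ → b ≡ b′ → c ≡ c′ → d ≡ d′ →
    sumOfSquares a b c d ≡ sumOfSquares a′ b′ c′ d′
  sumOfSquares-cong refl refl refl refl = refl

  square-abs : ∀ x → x * x ≡ + (∣ x ∣ ℕ.* ∣ x ∣)
  square-abs (+ n)    = sym (ℤ.pos-* n n)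
  square-abs -[1+ n ] = refl

  sumOfSquares-abs : ∀ a b c d →
    sumOfSquares a b c d ≡ + (∣ a ∣ ℕ.* ∣ a ∣ ℕ.+ ∣ b ∣ ℕ.* ∣ b ∣ ℕ.+ ∣ c ∣ ℕ.* ∣ c ∣ ℕ.+ ∣ d ∣ ℕ.* ∣ d ∣)
  sumOfSquares-abs a b c d = begin
    sumOfSquares a b c d
      ≡⟨ cong₂ _+_ (cong₂ _+_ (cong₂ _+_ (square-abs a) (square-abs b)) (square-abs c)) (square-abs d) ⟩
    + (∣ a ∣ ℕ.* ∣ a ∣) + + (∣ b ∣ ℕ.* ∣ b ∣) + + (∣ c ∣ ℕ.* ∣ c ∣) + + (∣ d ∣ ℕ.* ∣ d ∣) ∎
    where open ≡-Reasoning

  square≡0 : ∀ {a} → a ℕ.* a ≡ 0 → a ≡ 0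
  square≡0 {a} aa≡0 with ℕ.m*n≡0⇒m≡0∨n≡0 a aa≡0
  ... | inj₁ a≡0 = a≡0
  ... | inj₂ a≡0 = a≡0

  sumOfSquares≡0 : ∀ a b c d → a ℕ.* a ℕ.+ b ℕ.* b ℕ.+ c ℕ.* c ℕ.+ d ℕ.* d ≡ 0 → a ≡ 0 × b ≡ 0 × c ≡ 0 × d ≡ 0
  sumOfSquares≡0 a b c d Σ≡0 = square≡0 aa≡0 , square≡0 bb≡0 , square≡0 cc≡0 , square≡0 dd≡0
    where
    abc≡0 = ℕ.m+n≡0⇒m≡0 (a ℕ.* a ℕ.+ b ℕ.* b ℕ.+ c ℕ.* c) Σ≡0
    dd≡0  = ℕ.m+n≡0⇒n≡0 (a ℕ.* a ℕ.+ b ℕ.* b ℕ.+ c ℕ.* c) Σ≡0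
    ab≡0  = ℕ.m+n≡0⇒m≡0 (a ℕ.* a ℕ.+ b ℕ.* b) abc≡0
    cc≡0  = ℕ.m+n≡0⇒n≡0 (a ℕ.* a ℕ.+ b ℕ.* b) abc≡0
    aa≡0  = ℕ.m+n≡0⇒m≡0 (a ℕ.* a) ab≡0
    bb≡0  = ℕ.m+n≡0⇒n≡0 (a ℕ.* a) ab≡0

  -- Coordinatewise x ≡ y (mod m) makes every coordinate of Euler's product of x and y divisible by m.
  fourSquares-quotient : ∀ m {a b} .{{_ : NonZero m}} (y₁ y₂ y₃ y₄ q₁ q₂ q₃ q₄ : ℤ) →
    sumOfSquares (y₁ + + m * q₁) (y₂ + + m * q₂) (y₃ + + m * q₃) (y₄ + + m * q₄) ≡ + m * + a →
    sumOfSquares y₁ y₂ y₃ y₄ ≡ + m * + b →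
    FourSquares (a ℕ.* b)
  fourSquares-quotient m {a} {b} y₁ y₂ y₃ y₄ q₁ q₂ q₃ q₄ Σx≡ma Σy≡mb =
    fourSquares (+ b + s) w₂ w₃ w₄ (ℤ.*-cancelˡ-≡ M _ _ (ℤ.*-cancelˡ-≡ M _ _ (begin
      M * (M * sumOfSquares (+ b + s) w₂ w₃ w₄)                         ≡⟨ scale M (+ b + s) w₂ w₃ w₄ ⟨
      sumOfSquares (M * (+ b + s)) (M * w₂) (M * w₃) (M * w₄)
        ≡⟨ sumOfSquares-cong z₁≡ (z₂≡ M y₁ y₂ y₃ y₄ q₁ q₂ q₃ q₄) (z₃≡ M y₁ y₂ y₃ y₄ q₁ q₂ q₃ q₄) (z₄≡ M y₁ y₂ y₃ y₄ q₁ q₂ q₃ q₄) ⟨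
      sumOfSquares (x₁ * y₁ + x₂ * y₂ + x₃ * y₃ + x₄ * y₄) (x₁ * y₂ - x₂ * y₁ + x₃ * y₄ - x₄ * y₃)
                   (x₁ * y₃ - x₃ * y₁ + x₄ * y₂ - x₂ * y₄) (x₁ * y₄ - x₄ * y₁ + x₂ * y₃ - x₃ * y₂)
        ≡⟨ euler-four-square x₁ x₂ x₃ x₄ y₁ y₂ y₃ y₄ ⟨
      sumOfSquares x₁ x₂ x₃ x₄ * sumOfSquares y₁ y₂ y₃ y₄                ≡⟨ cong₂ _*_ Σx≡ma Σy≡mb ⟩
      M * + a * (M * + b)                                                  ≡⟨ interchange M (+ a) (+ b) ⟩
      M * (M * (+ a * + b))                                                ≡⟨ cong (λ z → M * (M * z)) (ℤ.pos-* a b) ⟨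
      M * (M * + (a ℕ.* b))                                                ∎)))
    where
    open ≡-Reasoning
    M = + m
    x₁ = y₁ + M * q₁
    x₂ = y₂ + M * q₂
    x₃ = y₃ + M * q₃
    x₄ = y₄ + M * q₄
    s  = q₁ * y₁ + q₂ * y₂ + q₃ * y₃ + q₄ * y₄
    w₂ = q₁ * y₂ - q₂ * y₁ + q₃ * y₄ - q₄ * y₃
    w₃ = q₁ * y₃ - q₃ * y₁ + q₄ * y₂ - q₂ * y₄
    w₄ = q₁ * y₄ - q₄ * y₁ + q₂ * y₃ - q₃ * y₂

    z₁≡ : x₁ * y₁ + x₂ * y₂ + x₃ * y₃ + x₄ * y₄ ≡ M * (+ b + s)
    z₁≡ = begin
      x₁ * y₁ + x₂ * y₂ + x₃ * y₃ + x₄ * y₄ ≡⟨ expand M y₁ y₂ y₃ y₄ q₁ q₂ q₃ q₄ ⟩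
      sumOfSquares y₁ y₂ y₃ y₄ + M * s     ≡⟨ cong (_+ M * s) Σy≡mb ⟩
      M * + b + M * s                      ≡⟨ ℤ.*-distribˡ-+ M (+ b) s ⟨
      M * (+ b + s)                        ∎
      where
      expand : ∀ M y₁ y₂ y₃ y₄ q₁ q₂ q₃ q₄ →
        (y₁ + M * q₁) * y₁ + (y₂ + M * q₂) * y₂ + (y₃ + M * q₃) * y₃ + (y₄ + M * q₄) * y₄ ≡
        (y₁ * y₁ + y₂ * y₂ + y₃ * y₃ + y₄ * y₄) + M * (q₁ * y₁ + q₂ * y₂ + q₃ * y₃ + q₄ * y₄)
      expand = solve-∀

    z₂≡ : ∀ M y₁ y₂ y₃ y₄ q₁ q₂ q₃ q₄ →
      (y₁ + M * q₁) * y₂ - (y₂ + M * q₂) * y₁ + (y₃ + M * q₃) * y₄ - (y₄ + M * q₄) * y₃ ≡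
      M * (q₁ * y₂ - q₂ * y₁ + q₃ * y₄ - q₄ * y₃)
    z₂≡ = solve-∀

    z₃≡ : ∀ M y₁ y₂ y₃ y₄ q₁ q₂ q₃ q₄ →
      (y₁ + M * q₁) * y₃ - (y₃ + M * q₃) * y₁ + (y₄ + M * q₄) * y₂ - (y₂ + M * q₂) * y₄ ≡
      M * (q₁ * y₃ - q₃ * y₁ + q₄ * y₂ - q₂ * y₄)
    z₃≡ = solve-∀

    z₄≡ : ∀ M y₁ y₂ y₃ y₄ q₁ q₂ q₃ q₄ →
      (y₁ + M * q₁) * y₄ - (y₄ + M * q₄) * y₁ + (y₂ + M * q₂) * y₃ - (y₃ + M * q₃) * y₂ ≡
      M * (q₁ * y₄ - q₄ * y₁ + q₂ * y₃ - q₃ * y₂)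
    z₄≡ = solve-∀

    scale : ∀ M u₁ u₂ u₃ u₄ →
      (M * u₁) * (M * u₁) + (M * u₂) * (M * u₂) + (M * u₃) * (M * u₃) + (M * u₄) * (M * u₄) ≡
      M * (M * (u₁ * u₁ + u₂ * u₂ + u₃ * u₃ + u₄ * u₄))
    scale = solve-∀

    interchange : ∀ M a b → M * a * (M * b) ≡ M * (M * (a * b))
    interchange = solve-∀

  private
    quadruple-sumOfSquares : ∀ a b c d →
      4 ℕ.* (a ℕ.* a ℕ.+ b ℕ.* b ℕ.+ c ℕ.* c ℕ.+ d ℕ.* d) ≡
      (2 ℕ.* a) ℕ.* (2 ℕ.* a) ℕ.+ (2 ℕ.* b) ℕ.* (2 ℕ.* b) ℕ.+ (2 ℕ.* c) ℕ.* (2 ℕ.* c) ℕ.+ (2 ℕ.* d) ℕ.* (2 ℕ.* d)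
    quadruple-sumOfSquares = ℕ-Solver.solve-∀

    quadruple : ∀ n → n ℕ.+ n ℕ.+ n ℕ.+ n ≡ 4 ℕ.* n
    quadruple = ℕ-Solver.solve-∀

  square-≤ : ∀ {a b} → a ≤ b → a ℕ.* a ≤ b ℕ.* b
  square-≤ a≤b = ℕ.*-mono-≤ a≤b a≤b

  sumOfSquares-halves-≤ : ∀ {m} a b c d → 2 ℕ.* a ≤ m → 2 ℕ.* b ≤ m → 2 ℕ.* c ≤ m → 2 ℕ.* d ≤ m →
    a ℕ.* a ℕ.+ b ℕ.* b ℕ.+ c ℕ.* c ℕ.+ d ℕ.* d ≤ m ℕ.* m
  sumOfSquares-halves-≤ {m} a b c d 2a≤m 2b≤m 2c≤m 2d≤m = ℕ.*-cancelˡ-≤ 4 (begin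
    4 ℕ.* (a ℕ.* a ℕ.+ b ℕ.* b ℕ.+ c ℕ.* c ℕ.+ d ℕ.* d) ≡⟨ quadruple-sumOfSquares a b c d ⟩
    _ ≤⟨ ℕ.+-mono-≤ (ℕ.+-mono-≤ (ℕ.+-mono-≤ (square-≤ 2a≤m) (square-≤ 2b≤m)) (square-≤ 2c≤m)) (square-≤ 2d≤m) ⟩
    m ℕ.* m ℕ.+ m ℕ.* m ℕ.+ m ℕ.* m ℕ.+ m ℕ.* m         ≡⟨ quadruple (m ℕ.* m) ⟩
    4 ℕ.* (m ℕ.* m)                                     ∎)
    where open ℕ.≤-Reasoning

  sumOfSquares-halves-< : ∀ {m} a b c d → 2 ℕ.* a < m → 2 ℕ.* b ≤ m → 2 ℕ.* c ≤ m → 2 ℕ.* d ≤ m →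
    a ℕ.* a ℕ.+ b ℕ.* b ℕ.+ c ℕ.* c ℕ.+ d ℕ.* d < m ℕ.* m
  sumOfSquares-halves-< {m} a b c d 2a<m 2b≤m 2c≤m 2d≤m = ℕ.*-cancelˡ-< 4 _ _ (begin-strict
    4 ℕ.* (a ℕ.* a ℕ.+ b ℕ.* b ℕ.+ c ℕ.* c ℕ.+ d ℕ.* d) ≡⟨ quadruple-sumOfSquares a b c d ⟩
    _ <⟨ ℕ.+-mono-<-≤ (ℕ.+-mono-<-≤ (ℕ.+-mono-<-≤ (ℕ.*-mono-< 2a<m 2a<m) (square-≤ 2b≤m)) (square-≤ 2c≤m)) (square-≤ 2d≤m) ⟩
    m ℕ.* m ℕ.+ m ℕ.* m ℕ.+ m ℕ.* m ℕ.+ m ℕ.* m         ≡⟨ quadruple (m ℕ.* m) ⟩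
    4 ℕ.* (m ℕ.* m)                                     ∎)
    where open ℕ.≤-Reasoning

  module OddPrimeDescent {p} (p-prime : Prime p) (p-odd : ¬ 2 ∣ p) where

    private
      proper⇒∤ : ∀ {m} → 1 < m → m < p → ¬ m ∣ p
      proper⇒∤ 1<m m<p m∣p with prime⇒irreducible p-prime m∣p
      ... | inj₁ m≡1 = ℕ.<-irrefl (sym m≡1) 1<m
      ... | inj₂ m≡p = ℕ.<-irrefl m≡p m<p

      multiples⇒∣ : ∀ m .{{_ : NonZero m}} q₁ q₂ q₃ q₄ →
        sumOfSquares (+ m * q₁) (+ m * q₂) (+ m * q₃) (+ m * q₄) ≡ + m * + p → m ∣ p
      multiples⇒∣ m q₁ q₂ q₃ q₄ Σ≡mp = ∣⇒∣ᵤ (divides Q (ℤ.*-cancelˡ-≡ (+ m) _ _ (begin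
        + m * + p                                   ≡⟨ Σ≡mp ⟨
        sumOfSquares (+ m * q₁) (+ m * q₂) (+ m * q₃) (+ m * q₄) ≡⟨ factor (+ m) q₁ q₂ q₃ q₄ ⟩
        + m * (Q * + m)                             ∎)))
        where
        open ≡-Reasoning
        Q = q₁ * q₁ + q₂ * q₂ + q₃ * q₃ + q₄ * q₄
        factor : ∀ M q₁ q₂ q₃ q₄ →
          (M * q₁) * (M * q₁) + (M * q₂) * (M * q₂) + (M * q₃) * (M * q₃) + (M * q₄) * (M * q₄) ≡
          M * ((q₁ * q₁ + q₂ * q₂ + q₃ * q₃ + q₄ * q₄) * M)
        factor = solve-∀

      even-decomposition⇒2∣ : ∀ a s Q → + p ≡ + (2 ℕ.* a) + (+ 2 * s + + (2 ℕ.* a) * Q) → 2 ∣ p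
      even-decomposition⇒2∣ a s Q p≡ = ∣⇒∣ᵤ (divides (+ a + s + + a * Q) (begin
        + p                                          ≡⟨ p≡ ⟩
        + (2 ℕ.* a) + (+ 2 * s + + (2 ℕ.* a) * Q)    ≡⟨ cong (λ z → z + (+ 2 * s + z * Q)) (ℤ.pos-* 2 a) ⟩
        + 2 * + a + (+ 2 * s + + 2 * + a * Q)        ≡⟨ halve (+ a) s Q ⟩
        (+ a + s + + a * Q) * + 2                    ∎))
        where
        open ≡-Reasoning
        halve : ∀ A s Q → + 2 * A + (+ 2 * s + + 2 * A * Q) ≡ (A + s + A * Q) * + 2
        halve = solve-∀

      residue-expansion : ∀ M y₁ y₂ y₃ y₄ q₁ q₂ q₃ q₄ →
        (y₁ + M * q₁) * (y₁ + M * q₁) + (y₂ + M * q₂) * (y₂ + M * q₂) + (y₃ + M * q₃) * (y₃ + M * q₃) + (y₄ + M * q₄) * (y₄ + M * q₄) ≡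
        (y₁ * y₁ + y₂ * y₂ + y₃ * y₃ + y₄ * y₄) +
          M * (+ 2 * (y₁ * q₁ + y₂ * q₂ + y₃ * q₃ + y₄ * q₄) + M * (q₁ * q₁ + q₂ * q₂ + q₃ * q₃ + q₄ * q₄))
      residue-expansion = solve-∀

    descend : ∀ {m x₁ x₂ x₃ x₄} → 1 < m → m < p → sumOfSquares x₁ x₂ x₃ x₄ ≡ + (m ℕ.* p) →
      SymmetricResidue m x₁ → SymmetricResidue m x₂ → SymmetricResidue m x₃ → SymmetricResidue m x₄ →
      ∃[ r ] 0 < r × r < m × FourSquares (r ℕ.* p)
    descend {m} 1<m m<p Σx≡mp (symmetricResidue y₁ q₁ refl b₁) (symmetricResidue y₂ q₂ refl b₂)
                                (symmetricResidue y₃ q₃ refl b₃) (symmetricResidue y₄ q₄ refl b₄) =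
      r , ℕ.n≢0⇒n>0 r≢0 , ℕ.≤∧≢⇒< r≤m r≢m ,
      subst FourSquares (ℕ.*-comm p r) (fourSquares-quotient m y₁ y₂ y₃ y₄ q₁ q₂ q₃ q₄ Σx≡Mp Σy≡Mr)
      where
      open ≡-Reasoning
      instance
        m≢0 : NonZero m
        m≢0 = ℕ.>-nonZero (ℕ.<-trans ℕ.z<s 1<m)
      M = + m
      a₁ = ∣ y₁ ∣
      a₂ = ∣ y₂ ∣
      a₃ = ∣ y₃ ∣
      a₄ = ∣ y₄ ∣
      Y = a₁ ℕ.* a₁ ℕ.+ a₂ ℕ.* a₂ ℕ.+ a₃ ℕ.* a₃ ℕ.+ a₄ ℕ.* a₄
      s = y₁ * q₁ + y₂ * q₂ + y₃ * q₃ + y₄ * q₄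
      T = + 2 * s + M * (q₁ * q₁ + q₂ * q₂ + q₃ * q₃ + q₄ * q₄)

      Σx≡Mp : sumOfSquares (y₁ + M * q₁) (y₂ + M * q₂) (y₃ + M * q₃) (y₄ + M * q₄) ≡ M * + p
      Σx≡Mp = trans Σx≡mp (ℤ.pos-* m p)

      Y≡M[p-T] : + Y ≡ M * (+ p - T)
      Y≡M[p-T] = begin
        + Y                                        ≡⟨ sumOfSquares-abs y₁ y₂ y₃ y₄ ⟨
        sumOfSquares y₁ y₂ y₃ y₄                   ≡⟨ isolate (sumOfSquares y₁ y₂ y₃ y₄) M T ⟩
        sumOfSquares y₁ y₂ y₃ y₄ + M * T - M * T   ≡⟨ cong (_- M * T) (trans (sym (residue-expansion M y₁ y₂ y₃ y₄ q₁ q₂ q₃ q₄)) Σx≡Mp) ⟩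
        M * + p - M * T                            ≡⟨ factor M (+ p) T ⟩
        M * (+ p - T)                              ∎
        where
        isolate : ∀ Y M T → Y ≡ Y + M * T - M * T
        isolate = solve-∀
        factor : ∀ M P T → M * P - M * T ≡ M * (P - T)
        factor = solve-∀

      m∣Y : m ∣ Y
      m∣Y = ∣⇒∣ᵤ (divides (+ p - T) (trans Y≡M[p-T] (ℤ.*-comm M (+ p - T))))

      r = ℕ.quotient m∣Y

      Y≡Mr : + Y ≡ M * + r
      Y≡Mr = begin
        + Y          ≡⟨ cong +_ (ℕ.m∣n⇒n≡m*quotient m∣Y) ⟩
        + (m ℕ.* r)  ≡⟨ ℤ.pos-* m r ⟩
        M * + r      ∎

      Σy≡Mr : sumOfSquares y₁ y₂ y₃ y₄ ≡ M * + r
      Σy≡Mr = trans (sumOfSquares-abs y₁ y₂ y₃ y₄) Y≡Mr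

      p≡r+T : + p ≡ + r + T
      p≡r+T = trans (shift (+ p) T) (cong (_+ T) (ℤ.*-cancelˡ-≡ M _ _ (trans (sym Y≡M[p-T]) Y≡Mr)))
        where
        shift : ∀ P T → P ≡ P - T + T
        shift = solve-∀

      r≤m : r ≤ m
      r≤m = ℕ.*-cancelˡ-≤ m (subst (_≤ m ℕ.* m) (ℕ.m∣n⇒n≡m*quotient m∣Y) (sumOfSquares-halves-≤ a₁ a₂ a₃ a₄ b₁ b₂ b₃ b₄))

      -- r = 0 forces y = 0, hence m² ∣ Σ xᵢ² = m p.
      r≢0 : r ≢ 0
      r≢0 r≡0 = proper⇒∤ 1<m m<p (multiples⇒∣ m q₁ q₂ q₃ q₄
        (trans (sym (sumOfSquares-cong (vanish y₁≡0) (vanish y₂≡0) (vanish y₃≡0) (vanish y₄≡0))) Σx≡Mp))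
        where
        Y≡0 : Y ≡ 0
        Y≡0 = trans (ℕ.m∣n⇒n≡m*quotient m∣Y) (trans (cong (m ℕ.*_) r≡0) (ℕ.*-zeroʳ m))
        vanish : ∀ {y q} → y ≡ 0ℤ → y + M * q ≡ M * q
        vanish {q = q} y≡0 = trans (cong (_+ M * q) y≡0) (ℤ.+-identityˡ (M * q))
        squares≡0 = sumOfSquares≡0 a₁ a₂ a₃ a₄ Y≡0
        y₁≡0 : y₁ ≡ 0ℤ
        y₁≡0 = ℤ.∣i∣≡0⇒i≡0 (proj₁ squares≡0)
        y₂≡0 : y₂ ≡ 0ℤ
        y₂≡0 = ℤ.∣i∣≡0⇒i≡0 (proj₁ (proj₂ squares≡0))
        y₃≡0 : y₃ ≡ 0ℤ
        y₃≡0 = ℤ.∣i∣≡0⇒i≡0 (proj₁ (proj₂ (proj₂ squares≡0)))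
        y₄≡0 : y₄ ≡ 0ℤ
        y₄≡0 = ℤ.∣i∣≡0⇒i≡0 (proj₂ (proj₂ (proj₂ squares≡0)))

      -- r = m forces 2|y₁| = m, so m is even, and then p = m + T is even too.
      r≢m : r ≢ m
      r≢m r≡m with 2 ℕ.* ∣ y₁ ∣ ℕ.<? m
      ... | yes 2y₁<m = ℕ.<-irrefl Y≡mm (sumOfSquares-halves-< a₁ a₂ a₃ a₄ 2y₁<m b₂ b₃ b₄)
        where
        Y≡mm : Y ≡ m ℕ.* m
        Y≡mm = trans (ℕ.m∣n⇒n≡m*quotient m∣Y) (cong (m ℕ.*_) r≡m)
      ... | no 2y₁≮m = p-odd (even-decomposition⇒2∣ ∣ y₁ ∣ s (q₁ * q₁ + q₂ * q₂ + q₃ * q₃ + q₄ * q₄) (begin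
        + p      ≡⟨ p≡r+T ⟩
        + r + T  ≡⟨ cong₂ (λ u v → + u + (+ 2 * s + + v * (q₁ * q₁ + q₂ * q₂ + q₃ * q₃ + q₄ * q₄)))
                          (trans r≡m (sym 2y₁≡m)) (sym 2y₁≡m) ⟩
        _ ∎))
        where
        2y₁≡m : 2 ℕ.* ∣ y₁ ∣ ≡ m
        2y₁≡m = ℕ.≤-antisym b₁ (ℕ.≮⇒≥ 2y₁≮m)

    descentStep : ∀ {m} → 1 < m → m < p → FourSquares (m ℕ.* p) → ∃[ r ] 0 < r × r < m × FourSquares (r ℕ.* p)
    descentStep {m} 1<m m<p (fourSquares x₁ x₂ x₃ x₄ Σx≡mp) =
      descend 1<m m<p Σx≡mp (reduceSymmetric m x₁) (reduceSymmetric m x₂) (reduceSymmetric m x₃) (reduceSymmetric m x₄)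
      where
      instance
        m≢0 : NonZero m
        m≢0 = ℕ.>-nonZero (ℕ.<-trans ℕ.z<s 1<m)

    fourSquares-multiple⇒fourSquares : ∀ {m} → 0 < m → m < p → FourSquares (m ℕ.* p) → FourSquares p
    fourSquares-multiple⇒fourSquares {m} = go m (<-wellFounded m)
      where
      go : ∀ m → Acc _<_ m → 0 < m → m < p → FourSquares (m ℕ.* p) → FourSquares p
      go 0               _        () _   _
      go 1               _        _  _   sq = subst FourSquares (ℕ.*-identityˡ p) sq
      go m@(suc (suc _)) (acc rs) _  m<p sq with descentStep (s≤s (s≤s z≤n)) m<p sq
      ... | r , 0<r , r<m , sq′ = go r (rs r<m) 0<r (ℕ.<-trans r<m m<p) sq′

  %ℕ-≡⇒∣- : ∀ m .{{_ : NonZero m}} x y → x %ℕ m ≡ y %ℕ m → + m ℤ.∣ x - y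
  %ℕ-≡⇒∣- m x y x≡y = divides (x /ℕ m - y /ℕ m) (begin
    x - y                                                ≡⟨ cong₂ _-_ (ℤ.a≡a%ℕn+[a/ℕn]*n x m) (ℤ.a≡a%ℕn+[a/ℕn]*n y m) ⟩
    (+ (x %ℕ m) + x /ℕ m * + m) - (+ (y %ℕ m) + y /ℕ m * + m) ≡⟨ cong (λ r → (+ (x %ℕ m) + x /ℕ m * + m) - (+ r + y /ℕ m * + m)) x≡y ⟨
    (+ (x %ℕ m) + x /ℕ m * + m) - (+ (x %ℕ m) + y /ℕ m * + m) ≡⟨ cancel (+ (x %ℕ m)) (x /ℕ m) (y /ℕ m) (+ m) ⟩
    (x /ℕ m - y /ℕ m) * + m                              ∎)
    where
    open ≡-Reasoning
    cancel : ∀ r a b m → (r + a * m) - (r + b * m) ≡ (a - b) * m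
    cancel = solve-∀

  ∣-sym : ∀ {k} x y → k ℤ.∣ x - y → k ℤ.∣ y - x
  ∣-sym {k} x y k∣x-y = subst (k ℤ.∣_) (negate x y) (∣m⇒∣-m k∣x-y)
    where
    negate : ∀ x y → - (x - y) ≡ y - x
    negate = solve-∀

  module _ {h} (p-prime : Prime (suc (2 ℕ.* h))) where

    private
      p = suc (2 ℕ.* h)

      instance
        p≢0 : NonZero p
        p≢0 = _

      small⇒∤ : ∀ {n} → 0 < n → n < p → ¬ p ∣ n
      small⇒∤ 0<n n<p = ℕ.>⇒∤ {{ℕ.>-nonZero 0<n}} n<p

      p-odd : ¬ 2 ∣ p
      p-odd (divides q p≡q*2) = ℕ.even≢odd q h (trans (ℕ.*-comm 2 q) (sym p≡q*2))

      h<p : ∀ {n} → n ≤ h → n < p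
      h<p n≤h = s≤s (ℕ.≤-trans n≤h (ℕ.m≤m+n _ _))

    squares-incongruent : ∀ {x y} → x ≤ h → y ≤ h → x ≢ y → ¬ + p ℤ.∣ + x * + x - + y * + y
    squares-incongruent {x} {y} x≤h y≤h x≢y p∣x²-y² =
      [ p∤∣x-y∣ , p∤x+y ]′ (euclidsLemma ∣ + x - + y ∣ (x ℕ.+ y) p-prime p∣∣x-y∣[x+y])
      where
      factor : ∀ x y → x * x - y * y ≡ (x - y) * (x + y)
      factor = solve-∀
      p∣∣x-y∣[x+y] : p ∣ ∣ + x - + y ∣ ℕ.* (x ℕ.+ y)
      p∣∣x-y∣[x+y] = subst (p ∣_) (ℤ.abs-* (+ x - + y) (+ x + + y)) (∣⇒∣ᵤ (subst (+ p ℤ.∣_) (factor (+ x) (+ y)) p∣x²-y²))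
      ∣x-y∣≢0 : ∣ + x - + y ∣ ≢ 0
      ∣x-y∣≢0 eq = x≢y (ℤ.+-injective (ℤ.i-j≡0⇒i≡j (+ x) (+ y) (ℤ.∣i∣≡0⇒i≡0 eq)))
      ∣x-y∣≤h : ∣ + x - + y ∣ ≤ h
      ∣x-y∣≤h = subst (_≤ h) (cong ∣_∣ (sym (ℤ.[+m]-[+n]≡m⊖n x y))) (ℕ.≤-trans (ℤ.∣m⊝n∣≤m⊔n x y) (ℕ.⊔-lub x≤h y≤h))
      p∤∣x-y∣ : ¬ p ∣ ∣ + x - + y ∣
      p∤∣x-y∣ = small⇒∤ (ℕ.n≢0⇒n>0 ∣x-y∣≢0) (h<p ∣x-y∣≤h)
      x+y≢0 : x ℕ.+ y ≢ 0
      x+y≢0 eq = x≢y (trans (ℕ.m+n≡0⇒m≡0 x eq) (sym (ℕ.m+n≡0⇒n≡0 x eq)))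
      p∤x+y : ¬ p ∣ x ℕ.+ y
      p∤x+y = small⇒∤ (ℕ.n≢0⇒n>0 x+y≢0) (s≤s (ℕ.+-mono-≤ x≤h (ℕ.≤-trans y≤h (ℕ.m≤m+n h 0))))

    private
      candidate : Fin (suc h) ⊎ Fin (suc h) → ℤ
      candidate (inj₁ x) = + toℕ x * + toℕ x
      candidate (inj₂ y) = -1ℤ - + toℕ y * + toℕ y

      p<2[1+h] : p < suc h ℕ.+ suc h
      p<2[1+h] = s≤s (ℕ.≤-reflexive (double h))
        where
        double : ∀ h → suc (2 ℕ.* h) ≡ h ℕ.+ suc h
        double = ℕ-Solver.solve-∀

      toℕ≤h : (x : Fin (suc h)) → toℕ x ≤ h
      toℕ≤h = Fin.toℕ≤pred[n]

      mixed-collision : ∀ x y → + p ℤ.∣ + x * + x - (-1ℤ - + y * + y) → p ∣ suc (x ℕ.* x ℕ.+ y ℕ.* y)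
      mixed-collision x y p∣ = ∣⇒∣ᵤ (subst (+ p ℤ.∣_) (begin
        + x * + x - (-1ℤ - + y * + y)   ≡⟨ rearrange (+ x) (+ y) ⟩
        1ℤ + (+ x * + x + + y * + y)     ≡⟨ cong₂ (λ a b → 1ℤ + (a + b)) (ℤ.pos-* x x) (ℤ.pos-* y y) ⟨
        + suc (x ℕ.* x ℕ.+ y ℕ.* y)      ∎) p∣)
        where
        open ≡-Reasoning
        rearrange : ∀ x y → x * x - (-1ℤ - y * y) ≡ 1ℤ + (x * x + y * y)
        rearrange = solve-∀

      collision : ∀ u v → u ≢ v → + p ℤ.∣ candidate u - candidate v →
        ∃[ x ] ∃[ y ] x ≤ h × y ≤ h × p ∣ suc (x ℕ.* x ℕ.+ y ℕ.* y)
      collision (inj₁ x) (inj₁ x′) u≢v p∣ =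
        ⊥-elim (squares-incongruent (toℕ≤h x) (toℕ≤h x′) (λ eq → u≢v (cong inj₁ (Fin.toℕ-injective eq))) p∣)
      collision (inj₂ y) (inj₂ y′) u≢v p∣ =
        ⊥-elim (squares-incongruent (toℕ≤h y′) (toℕ≤h y) (λ eq → u≢v (cong inj₂ (Fin.toℕ-injective (sym eq))))
          (subst (+ p ℤ.∣_) (shift (+ toℕ y) (+ toℕ y′)) p∣))
        where
        shift : ∀ y y′ → (-1ℤ - y * y) - (-1ℤ - y′ * y′) ≡ y′ * y′ - y * y
        shift = solve-∀
      collision (inj₁ x) (inj₂ y) _ p∣ = toℕ x , toℕ y , toℕ≤h x , toℕ≤h y , mixed-collision (toℕ x) (toℕ y) p∣
      collision (inj₂ y) (inj₁ x) _ p∣ = toℕ x , toℕ y , toℕ≤h x , toℕ≤h y ,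
        mixed-collision (toℕ x) (toℕ y) (∣-sym (candidate (inj₂ y)) (candidate (inj₁ x)) p∣)

    -- The h + 1 values x² and the h + 1 values -1 - y² (0 ≤ x, y ≤ h) cannot all be distinct modulo p = 2h + 1.
    ∃-twoSquares+1-multiple : ∃[ x ] ∃[ y ] x ≤ h × y ≤ h × p ∣ suc (x ℕ.* x ℕ.+ y ℕ.* y)
    ∃-twoSquares+1-multiple with Fin.pigeonhole p<2[1+h] residue
      where
      residue : Fin (suc h ℕ.+ suc h) → Fin p
      residue i = fromℕ< (ℤ.n%ℕd<d (candidate (splitAt (suc h) i)) p)
    ... | i , j , i<j , residue≡ = collision (splitAt (suc h) i) (splitAt (suc h) j)
            (λ eq → Fin.<⇒≢ i<j (splitAt-injective eq))
            (%ℕ-≡⇒∣- p (candidate (splitAt (suc h) i)) (candidate (splitAt (suc h) j))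
              (trans (sym (Fin.toℕ-fromℕ< _)) (trans (cong toℕ residue≡) (Fin.toℕ-fromℕ< _))))
      where
      splitAt-injective : ∀ {i j} → splitAt (suc h) i ≡ splitAt (suc h) j → i ≡ j
      splitAt-injective {i} {j} eq =
        trans (sym (Fin.join-splitAt (suc h) (suc h) i)) (trans (cong (join (suc h) (suc h)) eq) (Fin.join-splitAt (suc h) (suc h) j))

    fourSquares-small-multiple : ∀ {x y} → x ≤ h → y ≤ h → p ∣ suc (x ℕ.* x ℕ.+ y ℕ.* y) →
      ∃[ m ] 0 < m × m < p × FourSquares (m ℕ.* p)
    fourSquares-small-multiple _ _ (divides zero ())
    fourSquares-small-multiple {x} {y} x≤h y≤h (divides m@(suc _) x²+y²+1≡mp) =
      m , ℕ.z<s , ℕ.*-cancelʳ-< p m p mp<pp , fourSquares (+ x) (+ y) 1ℤ 0ℤ Σ≡mp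
      where
      expand : ∀ h → suc (2 ℕ.* h) ℕ.* suc (2 ℕ.* h) ≡ suc (h ℕ.* h ℕ.+ h ℕ.* h) ℕ.+ (2 ℕ.* (h ℕ.* h) ℕ.+ 3 ℕ.* h ℕ.+ h)
      expand = ℕ-Solver.solve-∀
      0<h : 0 < h
      0<h = ℕ.n≢0⇒n>0 (λ h≡0 → ¬prime[1] (subst (λ h → Prime (suc (2 ℕ.* h))) h≡0 p-prime))
      mp<pp : m ℕ.* p < p ℕ.* p
      mp<pp = begin-strict
        m ℕ.* p                                          ≡⟨ x²+y²+1≡mp ⟨
        suc (x ℕ.* x ℕ.+ y ℕ.* y)                        ≤⟨ s≤s (ℕ.+-mono-≤ (square-≤ x≤h) (square-≤ y≤h)) ⟩
        suc (h ℕ.* h ℕ.+ h ℕ.* h)                        <⟨ ℕ.m<m+n _ (ℕ.<-≤-trans 0<h (ℕ.m≤n+m h _)) ⟩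
        suc (h ℕ.* h ℕ.+ h ℕ.* h) ℕ.+ (2 ℕ.* (h ℕ.* h) ℕ.+ 3 ℕ.* h ℕ.+ h) ≡⟨ expand h ⟨
        p ℕ.* p                                          ∎
        where open ℕ.≤-Reasoning
      Σ≡mp : sumOfSquares (+ x) (+ y) 1ℤ 0ℤ ≡ + (m ℕ.* p)
      Σ≡mp = trans (sumOfSquares-abs (+ x) (+ y) 1ℤ 0ℤ) (cong +_ (trans (squares+1 x y) x²+y²+1≡mp))
        where
        squares+1 : ∀ x y → x ℕ.* x ℕ.+ y ℕ.* y ℕ.+ 1 ℕ.* 1 ℕ.+ 0 ℕ.* 0 ≡ suc (x ℕ.* x ℕ.+ y ℕ.* y)
        squares+1 = ℕ-Solver.solve-∀

    fourSquares-oddPrime : FourSquares p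
    fourSquares-oddPrime = fromTwoSquares ∃-twoSquares+1-multiple
      where
      fromTwoSquares : ∃[ x ] ∃[ y ] x ≤ h × y ≤ h × p ∣ suc (x ℕ.* x ℕ.+ y ℕ.* y) → FourSquares p
      fromTwoSquares (x , y , x≤h , y≤h , p∣x²+y²+1) with fourSquares-small-multiple x≤h y≤h p∣x²+y²+1
      ... | m , 0<m , m<p , representation = OddPrimeDescent.fourSquares-multiple⇒fourSquares p-prime p-odd 0<m m<p representation

  odd⇒suc-double : ∀ {n} → ¬ 2 ∣ n → n ≡ suc (2 ℕ.* (n / 2))
  odd⇒suc-double {n} 2∤n with n % 2 in n%2≡r | m%n<n n 2
  ... | 0           | _ = ⊥-elim (2∤n (m%n≡0⇒n∣m n 2 n%2≡r))
  ... | 1           | _ = trans (m≡m%n+[m/n]*n n 2) (cong₂ ℕ._+_ n%2≡r (ℕ.*-comm (n / 2) 2))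
  ... | suc (suc _) | s≤s (s≤s ())

  fourSquares-prime : ∀ {p} → Prime p → FourSquares p
  fourSquares-prime {p} p-prime with 2 ∣? p
  ... | no 2∤p = subst FourSquares (sym p≡1+2h) (fourSquares-oddPrime {p / 2} (subst Prime p≡1+2h p-prime))
    where
    p≡1+2h = odd⇒suc-double 2∤p
  ... | yes 2∣p with prime⇒irreducible p-prime 2∣p
  ...   | inj₁ ()
  ...   | inj₂ refl = fourSquares 1ℤ 1ℤ 0ℤ 0ℤ refl

  fourSquares-product : ∀ {ps} → All Prime ps → FourSquares (product ps)
  fourSquares-product []                   = fourSquares 1ℤ 0ℤ 0ℤ 0ℤ refl
  fourSquares-product (p-prime ∷ ps-prime) = fourSquares-* (fourSquares-prime p-prime) (fourSquares-product ps-prime)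

  lagrange-four-square : ∀ n → FourSquares n
  lagrange-four-square zero      = fourSquares 0ℤ 0ℤ 0ℤ 0ℤ refl
  lagrange-four-square n@(suc _) = subst FourSquares (sym isFactorisation) (fourSquares-product factorsPrime)
    where open PrimeFactorisation (factorise n)

module OddSquares where

  open Lagrange using (sumOfSquares; FourSquares; fourSquares)
  open import Data.Integer as ℤ using (ℤ; +_; -[1+_]; _+_; _*_; _-_; -_; 1ℤ; _%ℕ_; _/ℕ_)
  import Data.Integer.Properties as ℤ
  import Data.Integer.DivMod as ℤ
  open import Data.Integer.Tactic.RingSolver using (solve-∀)

  odd² : ℕ → ℕ
  odd² b = suc (2 ℕ.* b) ℕ.* suc (2 ℕ.* b)

  square≡self+even : ∀ x → ∃[ e ] x * x ≡ x + + 2 * e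
  square≡self+even x =
    subst (λ x → ∃[ e ] x * x ≡ x + + 2 * e) (sym (ℤ.a≡a%ℕn+[a/ℕn]*n x 2)) (byParity (x %ℕ 2) (ℤ.n%ℕd<d x 2))
    where
    q = x /ℕ 2
    even : ∀ q → (+ 0 + q * + 2) * (+ 0 + q * + 2) ≡ (+ 0 + q * + 2) + + 2 * (+ 2 * q * q - q)
    even = solve-∀
    odd : ∀ q → (+ 1 + q * + 2) * (+ 1 + q * + 2) ≡ (+ 1 + q * + 2) + + 2 * (+ 2 * q * q + q)
    odd = solve-∀
    byParity : ∀ r → r < 2 → ∃[ e ] (+ r + q * + 2) * (+ r + q * + 2) ≡ (+ r + q * + 2) + + 2 * e
    byParity 0 _ = _ , even q
    byParity 1 _ = _ , odd q
    byParity (suc (suc _)) (s≤s (s≤s ()))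

  odd-square : ∀ c → ∃[ b ] (1ℤ + + 2 * c) * (1ℤ + + 2 * c) ≡ + odd² b
  odd-square (+ b) = b , (begin
    (1ℤ + + 2 * + b) * (1ℤ + + 2 * + b)       ≡⟨ cong (λ n → (1ℤ + n) * (1ℤ + n)) (ℤ.pos-* 2 b) ⟨
    + suc (2 ℕ.* b) * + suc (2 ℕ.* b)         ≡⟨ ℤ.pos-* (suc (2 ℕ.* b)) (suc (2 ℕ.* b)) ⟨
    + odd² b                                  ∎)
    where open ≡-Reasoning
  odd-square -[1+ b ] = b , trans (negate (+ b)) (proj₂ (odd-square (+ b)))
    where
    negate : ∀ c → (1ℤ + + 2 * (- (1ℤ + c))) * (1ℤ + + 2 * (- (1ℤ + c))) ≡ (1ℤ + + 2 * c) * (1ℤ + + 2 * c)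
    negate = solve-∀

  sumOfSquares-odd⇒sum-odd : ∀ {h} x₁ x₂ x₃ x₄ → sumOfSquares x₁ x₂ x₃ x₄ ≡ + suc (2 ℕ.* h) →
    ∃[ c ] x₁ ≡ 1ℤ + + 2 * c - x₂ - x₃ - x₄
  sumOfSquares-odd⇒sum-odd {h} x₁ x₂ x₃ x₄ Σx≡t
    with square≡self+even x₁ | square≡self+even x₂ | square≡self+even x₃ | square≡self+even x₄
  ... | e₁ , x₁²≡ | e₂ , x₂²≡ | e₃ , x₃²≡ | e₄ , x₄²≡ = + h - E , (begin
    x₁                                                                 ≡⟨ isolate x₁ x₂ x₃ x₄ e₁ e₂ e₃ e₄ ⟩
    (x₁ + + 2 * e₁) + (x₂ + + 2 * e₂) + (x₃ + + 2 * e₃) + (x₄ + + 2 * e₄) - + 2 * E - x₂ - x₃ - x₄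
                                                                       ≡⟨ cong (λ Σ → Σ - + 2 * E - x₂ - x₃ - x₄) Σ≡t ⟩
    + suc (2 ℕ.* h) - + 2 * E - x₂ - x₃ - x₄                           ≡⟨ cong (λ n → (1ℤ + n) - + 2 * E - x₂ - x₃ - x₄) (ℤ.pos-* 2 h) ⟩
    1ℤ + + 2 * + h - + 2 * E - x₂ - x₃ - x₄                            ≡⟨ factor (+ h) E x₂ x₃ x₄ ⟩
    1ℤ + + 2 * (+ h - E) - x₂ - x₃ - x₄                                ∎)
    where
    open ≡-Reasoning
    E = e₁ + e₂ + e₃ + e₄
    Σ≡t : (x₁ + + 2 * e₁) + (x₂ + + 2 * e₂) + (x₃ + + 2 * e₃) + (x₄ + + 2 * e₄) ≡ + suc (2 ℕ.* h)
    Σ≡t = trans (sym (cong₂ _+_ (cong₂ _+_ (cong₂ _+_ x₁²≡ x₂²≡) x₃²≡) x₄²≡)) Σx≡t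
    isolate : ∀ x₁ x₂ x₃ x₄ e₁ e₂ e₃ e₄ →
      x₁ ≡ (x₁ + + 2 * e₁) + (x₂ + + 2 * e₂) + (x₃ + + 2 * e₃) + (x₄ + + 2 * e₄) - + 2 * (e₁ + e₂ + e₃ + e₄) - x₂ - x₃ - x₄
    isolate = solve-∀
    factor : ∀ h E x₂ x₃ x₄ → 1ℤ + + 2 * h - + 2 * E - x₂ - x₃ - x₄ ≡ 1ℤ + + 2 * (h - E) - x₂ - x₃ - x₄
    factor = solve-∀

  -- x₁ is eliminated through s = x₁ + x₂ + x₃ + x₄ = 1 + 2c, which turns s, s - 2(x₃ + x₄), s - 2(x₂ + x₄),
  -- s - 2(x₂ + x₃) into the 1 + 2cⱼ below.
  fourOddSquares : ∀ {n} x₁ x₂ x₃ x₄ → sumOfSquares x₁ x₂ x₃ x₄ ≡ + n → ∃[ c ] x₁ ≡ 1ℤ + + 2 * c - x₂ - x₃ - x₄ →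
    ∃[ b₁ ] ∃[ b₂ ] ∃[ b₃ ] ∃[ b₄ ] odd² b₁ ℕ.+ odd² b₂ ℕ.+ odd² b₃ ℕ.+ odd² b₄ ≡ 4 ℕ.* n
  fourOddSquares {n} x₁ x₂ x₃ x₄ Σx≡n (c , x₁≡)
    with odd-square c | odd-square (c - x₃ - x₄) | odd-square (c - x₂ - x₄) | odd-square (c - x₂ - x₃)
  ... | b₁ , u₁²≡ | b₂ , u₂²≡ | b₃ , u₃²≡ | b₄ , u₄²≡ = b₁ , b₂ , b₃ , b₄ , ℤ.+-injective (begin
    + (odd² b₁ ℕ.+ odd² b₂ ℕ.+ odd² b₃ ℕ.+ odd² b₄)                ≡⟨ cong₂ _+_ (cong₂ _+_ (cong₂ _+_ u₁²≡ u₂²≡) u₃²≡) u₄²≡ ⟨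
    sumOfSquares (1ℤ + + 2 * c) (1ℤ + + 2 * (c - x₃ - x₄)) (1ℤ + + 2 * (c - x₂ - x₄)) (1ℤ + + 2 * (c - x₂ - x₃))
                                                                   ≡⟨ forms c x₂ x₃ x₄ ⟩
    + 4 * sumOfSquares (1ℤ + + 2 * c - x₂ - x₃ - x₄) x₂ x₃ x₄      ≡⟨ cong (λ x → + 4 * sumOfSquares x x₂ x₃ x₄) x₁≡ ⟨
    + 4 * sumOfSquares x₁ x₂ x₃ x₄                                 ≡⟨ cong (+ 4 *_) Σx≡n ⟩
    + 4 * + n                                                      ≡⟨ ℤ.pos-* 4 n ⟨
    + (4 ℕ.* n)                                                    ∎)
    where
    open ≡-Reasoning
    forms : ∀ c x₂ x₃ x₄ →
        (1ℤ + + 2 * c) * (1ℤ + + 2 * c) + (1ℤ + + 2 * (c - x₃ - x₄)) * (1ℤ + + 2 * (c - x₃ - x₄))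
      + (1ℤ + + 2 * (c - x₂ - x₄)) * (1ℤ + + 2 * (c - x₂ - x₄)) + (1ℤ + + 2 * (c - x₂ - x₃)) * (1ℤ + + 2 * (c - x₂ - x₃)) ≡
      + 4 * ((1ℤ + + 2 * c - x₂ - x₃ - x₄) * (1ℤ + + 2 * c - x₂ - x₃ - x₄) + x₂ * x₂ + x₃ * x₃ + x₄ * x₄)
    forms = solve-∀

  fourSquares⇒fourOddSquares : ∀ h → FourSquares (suc (2 ℕ.* h)) →
    ∃[ b₁ ] ∃[ b₂ ] ∃[ b₃ ] ∃[ b₄ ] odd² b₁ ℕ.+ odd² b₂ ℕ.+ odd² b₃ ℕ.+ odd² b₄ ≡ 4 ℕ.* suc (2 ℕ.* h)
  fourSquares⇒fourOddSquares h (fourSquares x₁ x₂ x₃ x₄ Σx≡t) =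
    fourOddSquares x₁ x₂ x₃ x₄ Σx≡t (sumOfSquares-odd⇒sum-odd {h} x₁ x₂ x₃ x₄ Σx≡t)

open Lagrange using (square-≤; lagrange-four-square; odd⇒suc-double)
open OddSquares using (odd²; fourSquares⇒fourOddSquares)
open import Data.Nat using (_+_; _*_)
open import Data.Nat.ListAction using (sum)
open import Data.Nat.ListAction.Properties using (sum-↭)
open import Data.List using ([]; _∷_; map; length)
open import Data.List.Relation.Unary.All as All using (All; []; _∷_)
open import Data.List.Relation.Unary.All.Properties using (map⁻)
open import Data.List.Relation.Unary.Linked using ([-]; _∷_)
open import Data.List.Relation.Binary.Permutation.Propositional using (_↭_; ↭-sym)
open import Data.List.Relation.Binary.Permutation.Propositional.Properties using (↭-length; All-resp-↭; map⁺)
open import Relation.Binary.Properties.DecTotalOrder ℕ.≤-decTotalOrder using (≥-decTotalOrder)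
open import Data.List.Sort ≥-decTotalOrder using (sort; sort-↭; sort-↗)
open import Relation.Binary.Bundles using (DecTotalOrder)
open import Data.List.Relation.Unary.Sorted.TotalOrder (DecTotalOrder.totalOrder ≥-decTotalOrder) using (Sorted)
open import Data.Nat.Tactic.RingSolver using (solve-∀)

pronic-even : ∀ n → ∃[ e ] n * suc n ≡ 2 * e
pronic-even zero    = 0 , refl
pronic-even (suc n) with pronic-even n
... | e , n[1+n]≡2e = e + suc n , (begin
  suc n * suc (suc n)     ≡⟨ step n ⟩
  n * suc n + 2 * suc n   ≡⟨ cong (_+ 2 * suc n) n[1+n]≡2e ⟩
  2 * e + 2 * suc n       ≡⟨ ℕ.*-distribˡ-+ 2 e (suc n) ⟨
  2 * (e + suc n)         ∎)
  where
  open ≡-Reasoning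
  step : ∀ n → suc n * suc (suc n) ≡ n * suc n + 2 * suc n
  step = solve-∀

entry-identity : ∀ k b → 8 * entry (suc (2 * (k + b))) k + odd² b ≡ odd² (k + b)
entry-identity k b with pronic-even k
... | e , k[1+k]≡2e = begin
  8 * entry t k + odd² b                 ≡⟨ cong (λ n → 8 * n + odd² b) entry≡ ⟩
  8 * (e + k * b) + odd² b               ≡⟨ cong (_+ odd² b) (regroup e (k * b)) ⟩
  4 * (2 * e) + 8 * (k * b) + odd² b     ≡⟨ cong (λ n → 4 * n + 8 * (k * b) + odd² b) k[1+k]≡2e ⟨
  4 * (k * suc k) + 8 * (k * b) + odd² b ≡⟨ expand k b ⟩
  odd² (k + b)                           ∎
  where
  open ≡-Reasoning
  t = suc (2 * (k + b))
  regroup : ∀ e x → 8 * (e + x) ≡ 4 * (2 * e) + 8 * x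
  regroup = solve-∀
  expand : ∀ k b → 4 * (k * suc k) + 8 * (k * b) + suc (2 * b) * suc (2 * b) ≡ suc (2 * (k + b)) * suc (2 * (k + b))
  expand = solve-∀
  t∸k : t ∸ k ≡ suc k + 2 * b
  t∸k = trans (cong (_∸ k) (split k b)) (ℕ.m+n∸m≡n k (suc k + 2 * b))
    where
    split : ∀ k b → suc (2 * (k + b)) ≡ k + (suc k + 2 * b)
    split = solve-∀
  entry≡ : entry t k ≡ e + k * b
  entry≡ = begin
    k * (t ∸ k) / 2          ≡⟨ cong (λ n → k * n / 2) t∸k ⟩
    k * (suc k + 2 * b) / 2  ≡⟨ cong (_/ 2) (distribute k b) ⟩
    (k * suc k + 2 * (k * b)) / 2 ≡⟨ cong (λ n → (n + 2 * (k * b)) / 2) k[1+k]≡2e ⟩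
    (2 * e + 2 * (k * b)) / 2     ≡⟨ cong (_/ 2) (sym (ℕ.*-distribˡ-+ 2 e (k * b))) ⟩
    2 * (e + k * b) / 2           ≡⟨ cong (_/ 2) (ℕ.*-comm 2 (e + k * b)) ⟩
    (e + k * b) * 2 / 2           ≡⟨ m*n/n≡m (e + k * b) 2 ⟩
    e + k * b                     ∎
    where
    distribute : ∀ k b → k * (suc k + 2 * b) ≡ k * suc k + 2 * (k * b)
    distribute = solve-∀

entry-complement : ∀ {h b} → b ≤ h → 8 * entry (suc (2 * h)) (h ∸ b) + odd² b ≡ odd² h
entry-complement {h} {b} b≤h =
  subst (λ n → 8 * entry (suc (2 * n)) (h ∸ b) + odd² b ≡ odd² n) (ℕ.m∸n+n≡m b≤h) (entry-identity (h ∸ b) b)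

odd²-bound : ∀ {h b} → odd² b ≤ 4 * suc (2 * h) → b ≤ h
odd²-bound {h} {b} odd²b≤4t = ℕ.≮⇒≥ λ h<b →
  ℕ.<⇒≱ 4t<odd²[1+h] (ℕ.≤-trans (square-≤ (s≤s (ℕ.*-monoʳ-≤ 2 h<b))) odd²b≤4t)
  where
  expand : ∀ h → suc (2 * suc h) * suc (2 * suc h) ≡ 4 * suc (2 * h) + suc (4 * (h * h) + 4 * h + 4)
  expand = solve-∀
  4t<odd²[1+h] : 4 * suc (2 * h) < odd² (suc h)
  4t<odd²[1+h] = subst (4 * suc (2 * h) <_) (sym (expand h)) (ℕ.m<m+n _ ℕ.z<s)

summands-≤ : ∀ a b c d → All (_≤ a + b + c + d) (a ∷ b ∷ c ∷ d ∷ [])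
summands-≤ a b c d =
  ℕ.≤-trans (ℕ.m≤m+n a b) abc≤ ∷ ℕ.≤-trans (ℕ.m≤n+m b a) abc≤ ∷ ℕ.≤-trans (ℕ.m≤n+m c (a + b)) abcd≤ ∷ ℕ.m≤n+m d (a + b + c) ∷ []
  where
  abcd≤ = ℕ.m≤m+n (a + b + c) d
  abc≤  = ℕ.≤-trans (ℕ.m≤m+n (a + b) c) abcd≤

entries-sum : ∀ h b₁ b₂ b₃ b₄ {e₁ e₂ e₃ e₄} →
  8 * e₁ + odd² b₁ ≡ odd² h → 8 * e₂ + odd² b₂ ≡ odd² h → 8 * e₃ + odd² b₃ ≡ odd² h → 8 * e₄ + odd² b₄ ≡ odd² h →
  odd² b₁ + odd² b₂ + odd² b₃ + odd² b₄ ≡ 4 * suc (2 * h) →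
  e₁ + e₂ + e₃ + e₄ ≡ suc (2 * h) * h
entries-sum h b₁ b₂ b₃ b₄ {e₁} {e₂} {e₃} {e₄} eq₁ eq₂ eq₃ eq₄ Σodd²≡4t =
  ℕ.*-cancelˡ-≡ _ _ 8 (ℕ.+-cancelʳ-≡ (4 * suc (2 * h)) _ _ (begin
    8 * (e₁ + e₂ + e₃ + e₄) + 4 * suc (2 * h)                         ≡⟨ cong (8 * (e₁ + e₂ + e₃ + e₄) +_) Σodd²≡4t ⟨
    8 * (e₁ + e₂ + e₃ + e₄) + (odd² b₁ + odd² b₂ + odd² b₃ + odd² b₄)
                                                                      ≡⟨ regroup e₁ e₂ e₃ e₄ (odd² b₁) (odd² b₂) (odd² b₃) (odd² b₄) ⟩
    (8 * e₁ + odd² b₁) + (8 * e₂ + odd² b₂) + (8 * e₃ + odd² b₃) + (8 * e₄ + odd² b₄)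
                                                                      ≡⟨ cong₂ _+_ (cong₂ _+_ (cong₂ _+_ eq₁ eq₂) eq₃) eq₄ ⟩
    odd² h + odd² h + odd² h + odd² h                                 ≡⟨ four-squares h ⟩
    8 * (suc (2 * h) * h) + 4 * suc (2 * h)                           ∎))
  where
  open ≡-Reasoning
  regroup : ∀ e₁ e₂ e₃ e₄ A₁ A₂ A₃ A₄ →
    8 * (e₁ + e₂ + e₃ + e₄) + (A₁ + A₂ + A₃ + A₄) ≡ (8 * e₁ + A₁) + (8 * e₂ + A₂) + (8 * e₃ + A₃) + (8 * e₄ + A₄)
  regroup = solve-∀
  four-squares : ∀ h →
    suc (2 * h) * suc (2 * h) + suc (2 * h) * suc (2 * h) + suc (2 * h) * suc (2 * h) + suc (2 * h) * suc (2 * h) ≡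
    8 * (suc (2 * h) * h) + 4 * suc (2 * h)
  four-squares = solve-∀

sort-descending₄ : ∀ a b c d → ∃[ w ] ∃[ x ] ∃[ y ] ∃[ z ]
  (w ∷ x ∷ y ∷ z ∷ []) ↭ (a ∷ b ∷ c ∷ d ∷ []) × x ≤ w × y ≤ x × z ≤ y
sort-descending₄ a b c d = fromSorted (sort abcd) (↭-length (sort-↭ abcd)) (sort-↭ abcd) (sort-↗ abcd)
  where
  abcd = a ∷ b ∷ c ∷ d ∷ []
  fromSorted : ∀ ks → length ks ≡ 4 → ks ↭ abcd → Sorted ks → ∃[ w ] ∃[ x ] ∃[ y ] ∃[ z ]
    (w ∷ x ∷ y ∷ z ∷ []) ↭ abcd × x ≤ w × y ≤ x × z ≤ y
  fromSorted (w ∷ x ∷ y ∷ z ∷ []) _ perm (x≤w ∷ y≤x ∷ z≤y ∷ [-]) = w , x , y , z , perm , x≤w , y≤x , z≤y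
  fromSorted []                        () _ _
  fromSorted (_ ∷ [])                  () _ _
  fromSorted (_ ∷ _ ∷ [])              () _ _
  fromSorted (_ ∷ _ ∷ _ ∷ [])          () _ _
  fromSorted (_ ∷ _ ∷ _ ∷ _ ∷ _ ∷ _)   () _ _

Distribution : ℕ → Set
Distribution t = Σ ℕ λ k₀ → Σ ℕ λ k₁ → Σ ℕ λ k₂ → Σ ℕ λ k₃ → IsDistribution t k₀ k₁ k₂ k₃

sort-distribution : ∀ t k₀ k₁ k₂ k₃ → All (_≤ (t ∸ 1) / 2) (k₀ ∷ k₁ ∷ k₂ ∷ k₃ ∷ []) →
  entry t k₀ + entry t k₁ + entry t k₂ + entry t k₃ ≡ t * (t ∸ 1) / 2 → Distribution t
sort-distribution t k₀ k₁ k₂ k₃ bounded Σ≡ = fromSorted (sort-descending₄ k₀ k₁ k₂ k₃)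
  where
  open ≡-Reasoning
  as-sum : ∀ a b c d → a + b + c + d ≡ a + (b + (c + (d + 0)))
  as-sum = solve-∀
  fromSorted : ∃[ w ] ∃[ x ] ∃[ y ] ∃[ z ] (w ∷ x ∷ y ∷ z ∷ []) ↭ (k₀ ∷ k₁ ∷ k₂ ∷ k₃ ∷ []) × x ≤ w × y ≤ x × z ≤ y →
    Distribution t
  fromSorted (w , x , y , z , perm , x≤w , y≤x , z≤y) =
    w , x , y , z , All.head (All-resp-↭ (↭-sym perm) bounded) , x≤w , y≤x , z≤y , (begin
      entry t w + entry t x + entry t y + entry t z          ≡⟨ as-sum (entry t w) (entry t x) (entry t y) (entry t z) ⟩
      sum (map (entry t) (w ∷ x ∷ y ∷ z ∷ []))               ≡⟨ sum-↭ (map⁺ (entry t) perm) ⟩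
      sum (map (entry t) (k₀ ∷ k₁ ∷ k₂ ∷ k₃ ∷ []))           ≡⟨ as-sum (entry t k₀) (entry t k₁) (entry t k₂) (entry t k₃) ⟨
      entry t k₀ + entry t k₁ + entry t k₂ + entry t k₃      ≡⟨ Σ≡ ⟩
      t * (t ∸ 1) / 2                                        ∎)

odd-squares⇒entries : ∀ h b₁ b₂ b₃ b₄ → odd² b₁ + odd² b₂ + odd² b₃ + odd² b₄ ≡ 4 * suc (2 * h) →
  let t = suc (2 * h) in entry t (h ∸ b₁) + entry t (h ∸ b₂) + entry t (h ∸ b₃) + entry t (h ∸ b₄) ≡ t * h
odd-squares⇒entries h b₁ b₂ b₃ b₄ Σodd²≡4t = entries bounds
  where
  bounds : All (_≤ h) (b₁ ∷ b₂ ∷ b₃ ∷ b₄ ∷ [])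
  bounds = All.map (λ le → odd²-bound (ℕ.≤-trans le (ℕ.≤-reflexive Σodd²≡4t)))
                   (map⁻ (summands-≤ (odd² b₁) (odd² b₂) (odd² b₃) (odd² b₄)))
  t = suc (2 * h)
  entries : All (_≤ h) (b₁ ∷ b₂ ∷ b₃ ∷ b₄ ∷ []) →
    entry t (h ∸ b₁) + entry t (h ∸ b₂) + entry t (h ∸ b₃) + entry t (h ∸ b₄) ≡ t * h
  entries (b₁≤h ∷ b₂≤h ∷ b₃≤h ∷ b₄≤h ∷ []) =
    entries-sum h b₁ b₂ b₃ b₄ {entry t (h ∸ b₁)} {entry t (h ∸ b₂)} {entry t (h ∸ b₃)} {entry t (h ∸ b₄)}
      (entry-complement b₁≤h) (entry-complement b₂≤h) (entry-complement b₃≤h) (entry-complement b₄≤h) Σodd²≡4t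

distribution-odd : ∀ h → Distribution (suc (2 * h))
distribution-odd h = fromOddSquares (fourSquares⇒fourOddSquares h (lagrange-four-square t))
  where
  t = suc (2 * h)
  half : 2 * h / 2 ≡ h
  half = trans (cong (_/ 2) (ℕ.*-comm 2 h)) (m*n/n≡m h 2)
  t*[t∸1]/2≡t*h : t * (2 * h) / 2 ≡ t * h
  t*[t∸1]/2≡t*h = trans (cong (_/ 2) (swap t h)) (m*n/n≡m (t * h) 2)
    where
    swap : ∀ t h → t * (2 * h) ≡ t * h * 2
    swap = solve-∀
  fromOddSquares : ∃[ b₁ ] ∃[ b₂ ] ∃[ b₃ ] ∃[ b₄ ] odd² b₁ + odd² b₂ + odd² b₃ + odd² b₄ ≡ 4 * t → Distribution t
  fromOddSquares (b₁ , b₂ , b₃ , b₄ , Σodd²≡4t) = sort-distribution t (h ∸ b₁) (h ∸ b₂) (h ∸ b₃) (h ∸ b₄)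
    (subst (λ n → All (_≤ n) (h ∸ b₁ ∷ h ∸ b₂ ∷ h ∸ b₃ ∷ h ∸ b₄ ∷ [])) (sym half)
      (ℕ.m∸n≤m h b₁ ∷ ℕ.m∸n≤m h b₂ ∷ ℕ.m∸n≤m h b₃ ∷ ℕ.m∸n≤m h b₄ ∷ []))
    (trans (odd-squares⇒entries h b₁ b₂ b₃ b₄ Σodd²≡4t) (sym t*[t∸1]/2≡t*h))

proposition2 : (t : ℕ) → 1 < t → ¬ (2 ∣ t) →
    Σ ℕ (λ k₀ → Σ ℕ (λ k₁ → Σ ℕ (λ k₂ → Σ ℕ (λ k₃ → IsDistribution t k₀ k₁ k₂ k₃))))
proposition2 t _ 2∤t = subst Distribution (sym (odd⇒suc-double 2∤t)) (distribution-odd (t / 2))
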